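{- Let $G_1,\ldots,G_n$ be nondeterministic automata, where $G_i$ has set of secret states $Q_i^S$, and consider the composed system $G_1\|\cdots\|G_n$ with interaction $\|_\land$, i.e. with set of secret states $Q^S=Q_1^S\times\cdots\times Q_n^S$. For $1\le i\le n$ let $H_i=\Delta(det(G_i))\|\Delta_R(det(G_{i,R}))$ be the two-way observer of $G_i$. If every state $((X^1,X^1_R),\ldots,(X^n,X^n_R))$ reachable in $H_1\|\cdots\|H_n$ has some index $i$ with $(X^i\cap X^i_R)\not\subseteq Q_i^S$ or $X^i\cap X^i_R=\emptyset$, then $G_1\|\cdots\|G_n$ is infinite-step opaque.
   Context: An automaton is $G=\langle\Sigma_\tau,Q,\to,Q^\circ\rangle$ with finite set $\Sigma$ of observable events, a special unobservable event $\tau\notin\Sigma$, $\Sigma_\tau=\Sigma\cup\{\tau\}$, finite states $Q$, transitions $\to\subseteq Q\times\Sigma_\tau\times Q$, initial states $Q^\circ$, and secret states $Q^S\subseteq Q$, $Q^{NS}=Q\setminus Q^S$. For $s\in\Sigma^*$, $p\stackrel{s}{\Rightarrow}q$ means there is $t\in\Sigma_\tau^*$ which becomes $s$ after deleting all $\tau$'s and $p\stackrel{t}{\to}q$; $p\stackrel{s}{\Rightarrow}$ means this for some $q$; $L(G,q)=\{s:q\stackrel{s}{\Rightarrow}\}$. Synchronous composition: states are tuples, initial states products of initial states; a shared event (other than $\tau$, never shared) is executed jointly by all components having it in their alphabet; other events are executed by a single component while the others stay put. Infinite-step opacity: $G$ is infinite-step opaque w.r.t. $Q^S$ iff for every $q^\circ\in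 Q^\circ$ and all $s,t\in\Sigma^*$ with $st\in L(G,q^\circ)$ and $q^\circ\stackrel{s}{\Rightarrow}Q^S$, there exist $q'^\circ\in Q^\circ$ and $y\in Q^{NS}$ with $q'^\circ\stackrel{s}{\Rightarrow}y$ and $y\stackrel{t}{\Rightarrow}$. Reversed automaton: $G_R=\langle\Sigma_\tau,Q,\to_R,Q\rangle$ with $(x,\sigma,y)\in\to_R$ iff $y\stackrel{\sigma}{\to}x$, all states initial. Current-state estimator: $UR(B)$ is the set of states reachable from $B$ by strings in $\{\tau\}^*$; $det(G)$ is the deterministic automaton over $\Sigma$ with initial state $UR(Q^\circ)$ and transitions $X\stackrel{\sigma}{\to}Y$ where $Y=\bigcup\{UR(\{y\}): x\stackrel{\sigma}{\to}y, x\in X\}$ is nonempty; only reachable states are kept. Renamings $\Delta(\sigma)=(\sigma,\epsilon)$, $\Delta_R(\sigma)=(\epsilon,\sigma)$ relabel transitions; the two-way observer $H_i=\Delta(det(G_i))\|\Delta_R(det(G_{i,R}))$ has event set $\Delta(\Sigma_i)\cup\Delta_R(\Sigma_i)$ and states $(X^i,X^i_R)$ with $X^i,X^i_R\subseteq Q_i$; $H_1\|\cdots\|H_n$ synchronizes on common renamed events. -}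

module Defs where

open import Data.Nat using (ℕ)
open import Data.Fin using (Fin)
open import Data.Fin.Subset using (Subset; _∈_; _∉_; ⊤; Nonempty)
open import Data.Bool using (Bool; T)
open import Data.Maybe using (Maybe; just; nothing)
open import Data.List using (List; []; _∷_; _++_)
open import Data.Product using (Σ; ∃; _×_; _,_; proj₁; proj₂)
open import Data.Sum using (_⊎_; inj₁; inj₂)
open import Data.Empty using (⊥)
open import Relation.Nullary using (¬_)
open import Relation.Binary.PropositionalEquality using (_≡_; _≢_)
open import Function.Bundles using (_⇔_)

-- Labelled transition systems over an event type E.
-- The unobservable event τ is `nothing`, observable events are `just e`.

record LTS (E : Set) : Set₁ where
  field
    State : Set
    Init  : State → Set
    Step  : State → Maybe E → State → Set
    Alph  : E → Set
open LTS public

data Run {E : Set} (G : LTS E) : State G → List E → State G → Set where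
  done : ∀ {p} → Run G p [] p
  tau  : ∀ {p q r s} → Step G p nothing q → Run G q s r → Run G p s r
  obs  : ∀ {p q r e s} → Step G p (just e) q → Run G q s r → Run G p (e ∷ s) r

data Reachable {E : Set} (G : LTS E) : State G → Set where
  start : ∀ {x} → Init G x → Reachable G x
  step : ∀ {x a y} → Reachable G x → Step G x a y → Reachable G y

InfStepOpaque : {E : Set} (G : LTS E) → (State G → Set) → Set
InfStepOpaque G QS =
  ∀ (q0 : State G) (s t : List _) → Init G q0 →
  (∃ λ z → Run G q0 (s ++ t) z) →
  (∃ λ q → Run G q0 s q × QS q) →
  ∃ λ q0' → ∃ λ y → Init G q0' × Run G q0' s y × ¬ QS y × (∃ λ z → Run G y t z)

-- Synchronous composition of a family of n systems.
-- τ is never shared; an observable event is executed jointly by all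
-- components having it in their alphabet, the others stay put.

Sync : {E : Set} (n : ℕ) → (Fin n → LTS E) → LTS E
Sync {E} n G = record
  { State = (i : Fin n) → State (G i)
  ; Init  = λ x → ∀ i → Init (G i) (x i)
  ; Step  = step'
  ; Alph  = λ e → ∃ λ i → Alph (G i) e
  }
  where
  step' : ((i : Fin n) → State (G i)) → Maybe E → ((i : Fin n) → State (G i)) → Set
  step' x nothing  y = ∃ λ i → Step (G i) (x i) nothing (y i) × (∀ j → j ≢ i → y j ≡ x j)
  step' x (just e) y = (∃ λ i → Alph (G i) e) ×
    (∀ i → (Alph (G i) e → Step (G i) (x i) (just e) (y i)) × (¬ Alph (G i) e → y i ≡ x i))

_∥_ : {E : Set} → LTS E → LTS E → LTS E
_∥_ {E} G₁ G₂ = record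
  { State = State G₁ × State G₂
  ; Init  = λ x → Init G₁ (proj₁ x) × Init G₂ (proj₂ x)
  ; Step  = step'
  ; Alph  = λ e → Alph G₁ e ⊎ Alph G₂ e
  }
  where
  step' : State G₁ × State G₂ → Maybe E → State G₁ × State G₂ → Set
  step' (x₁ , x₂) nothing (y₁ , y₂) =
    (Step G₁ x₁ nothing y₁ × y₂ ≡ x₂) ⊎ (Step G₂ x₂ nothing y₂ × y₁ ≡ x₁)
  step' (x₁ , x₂) (just e) (y₁ , y₂) = (Alph G₁ e ⊎ Alph G₂ e) ×
    ((Alph G₁ e → Step G₁ x₁ (just e) y₁) × (¬ Alph G₁ e → y₁ ≡ x₁)) ×
    ((Alph G₂ e → Step G₂ x₂ (just e) y₂) × (¬ Alph G₂ e → y₂ ≡ x₂))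

rename : {E E' : Set} → (E → E') → LTS E → LTS E'
rename {E} {E'} f G = record
  { State = State G
  ; Init  = Init G
  ; Step  = step'
  ; Alph  = λ e' → ∃ λ e → f e ≡ e' × Alph G e
  }
  where
  step' : State G → Maybe E' → State G → Set
  step' x nothing   y = Step G x nothing y
  step' x (just e') y = ∃ λ e → f e ≡ e' × Step G x (just e) y

-- Finite nondeterministic automata with k states over the global
-- observable alphabet Fin m; own alphabet Σᵢ = alph.

record Automaton (m : ℕ) : Set where
  field
    k      : ℕ
    trans  : Fin k → Maybe (Fin m) → Fin k → Bool
    init   : Subset k
    secret : Subset k
    alph   : Subset m
    wf     : ∀ p e q → T (trans p (just e) q) → e ∈ alph
open Automaton public

toLTS : ∀ {m} → Automaton m → LTS (Fin m)
toLTS G = record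
  { State = Fin (k G)
  ; Init  = λ q → q ∈ init G
  ; Step  = λ p a q → T (trans G p a q)
  ; Alph  = λ e → e ∈ alph G
  }

reverse : ∀ {m} → Automaton m → Automaton m
reverse G = record
  { k = k G
  ; trans = λ p a q → trans G q a p
  ; init = ⊤
  ; secret = secret G
  ; alph = alph G
  ; wf = λ p e q t → wf G q e p t
  }

InUR : ∀ {m} (G : Automaton m) → Subset (k G) → Fin (k G) → Set
InUR G B q = ∃ λ b → b ∈ B × Run (toLTS G) b [] q

-- current-state estimator det(G) (reachable part taken via Reachable)
det : ∀ {m} → Automaton m → LTS (Fin m)
det {m} G = record
  { State = Subset (k G)
  ; Init  = λ X → ∀ q → (q ∈ X) ⇔ InUR G (init G) q
  ; Step  = step'
  ; Alph  = λ e → e ∈ alph G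
  }
  where
  step' : Subset (k G) → Maybe (Fin m) → Subset (k G) → Set
  step' X nothing  Y = ⊥
  step' X (just σ) Y = Nonempty Y ×
    (∀ y → (y ∈ Y) ⇔ (∃ λ x → ∃ λ y' → x ∈ X × T (trans G x (just σ) y') × Run (toLTS G) y' [] y))

-- renamed events: inj₁ σ = (σ,ε), inj₂ σ = (ε,σ)
Δ : ∀ {m} → Fin m → Fin m ⊎ Fin m
Δ = inj₁

Δᵣ : ∀ {m} → Fin m → Fin m ⊎ Fin m
Δᵣ = inj₂

TwoWayObserver : ∀ {m} → Automaton m → LTS (Fin m ⊎ Fin m)
TwoWayObserver G = rename Δ (det G) ∥ rename Δᵣ (det (reverse G))

module Submission where

-- Let q₀ =s⇒ mid =t⇒ z be a run of the composition.  Reading s forward and then t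
-- backward, the composed observer reaches the state whose i-th component is
-- (X^i , X^i_R) with X^i = det(G_i) after the projection of s and X^i_R =
-- det(G_{i,R}) after the reversed projection of t; it contains mid i in both
-- parts.  So the hypothesis cannot give X^i ∩ X^i_R = ∅, and must give a
-- non-secret p ∈ X^i ∩ X^i_R: a state of G_i reached from an initial state by
-- the projection of s and continuing with the projection of t.  Rerouting
-- component i of the composed run through p (all other components unchanged)
-- gives a run of the composition on s ending in a non-secret state and
-- continuing with t.

open import Defs
open import Data.Nat using (ℕ; zero; suc)
open import Data.Fin using (Fin; punchIn; punchOut; _≟_)
open import Data.Fin.Properties using (any?; punchIn-punchOut; ¬∀⟶∃¬)
open import Data.Fin.Subset using (Subset; _∈_; _∉_; _∩_; _⊆_; ⊥; ⊤; Nonempty)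
open import Data.Fin.Subset.Properties using (_∈?_; ∈⊤; ∉⊥; x∈p∩q⁺; x∈p∩q⁻)
open import Data.Bool using (T)
open import Data.Bool.Properties using (T-≡)
open import Data.Maybe using (just; nothing)
open import Data.List using (List; []; _∷_; _++_; [_]; filter; allFin)
open import Data.List.Properties using (filter-++)
open import Data.List.Relation.Unary.All using (All; []; _∷_)
open import Data.List.Relation.Unary.Any using (here; there)
open import Data.List.Membership.Propositional using () renaming (_∈_ to _∈ₗ_)
open import Data.List.Membership.Propositional.Properties using (∈-allFin)
open import Data.Vec using (tabulate)
open import Data.Vec.Properties using ([]=⇒lookup; lookup⇒[]=; lookup∘tabulate)
open import Data.Product using (∃; ∃₂; _×_; _,_; proj₁; proj₂)
open import Data.Sum using (_⊎_; inj₁; inj₂)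
open import Data.Unit using (tt) renaming (⊤ to Unit)
open import Data.Empty using (⊥-elim)
open import Function using (_∘_; id)
open import Function.Bundles using (_⇔_; mk⇔; Equivalence)
open import Relation.Nullary using (¬_; Dec; yes; no)
open import Relation.Nullary.Decidable using (map′; _×-dec_; _⊎-dec_; _→-dec_; T?; isYes; toWitness; fromWitness)
open import Relation.Binary.PropositionalEquality
  using (_≡_; _≢_; refl; sym; subst; cong; module ≡-Reasoning) renaming (trans to ≡-trans)

module _ {E : Set} (L : LTS E) where

  run-++ : ∀ {p q r s t} → Run L p s q → Run L q t r → Run L p (s ++ t) r
  run-++ done       r′ = r′
  run-++ (tau st r) r′ = tau st (run-++ r r′)
  run-++ (obs st r) r′ = obs st (run-++ r r′)

  run-split : ∀ s {t p r} → Run L p (s ++ t) r → ∃ λ q → Run L p s q × Run L q t r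
  run-split []      r = _ , done , r
  run-split (σ ∷ s) (tau st r) with run-split (σ ∷ s) r
  ... | q , r₁ , r₂ = q , tau st r₁ , r₂
  run-split (σ ∷ s) (obs st r) with run-split s r
  ... | q , r₁ , r₂ = q , obs st r₁ , r₂

  run-uncons : ∀ {p r σ u} → Run L p (σ ∷ u) r →
    ∃₂ λ p′ q′ → Run L p [] p′ × Step L p′ (just σ) q′ × Run L q′ u r
  run-uncons (tau st r) with run-uncons r
  ... | p′ , q′ , r₀ , st′ , r₁ = p′ , q′ , tau st r₀ , st′ , r₁
  run-uncons (obs st r) = _ , _ , done , st , r

-- Reachability in a finite graph with decidable edges is decidable.  This is
-- what makes the successor sets of det(G) computable subsets.

module FiniteReachability {k : ℕ} (E : Fin k → Fin k → Set) (E? : ∀ p q → Dec (E p q)) where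

  data Path (P : Fin k → Set) : Fin k → Fin k → Set where
    ε   : ∀ {p} → Path P p p
    _◅_ : ∀ {p x q} → E p x × P x → Path P x q → Path P p q

  infixr 5 _◅_

  Reach : Fin k → Fin k → Set
  Reach = Path (λ _ → Unit)

  weaken : ∀ {P Q : Fin k → Set} → (∀ {v} → P v → Q v) → ∀ {p q} → Path P p q → Path Q p q
  weaken f ε              = ε
  weaken f ((e , x) ◅ ps) = (e , f x) ◅ weaken f ps

  -- Cutting a path after its last visit of r: what remains never visits r again.
  lastVisit : ∀ {P} r {p q} → Path P p q →
    Path (λ v → P v × v ≢ r) p q ⊎ Path (λ v → P v × v ≢ r) r q
  lastVisit r ε = inj₁ ε
  lastVisit r (_◅_ {x = x} (e , px) ps) with lastVisit r ps | x ≟ r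
  ... | inj₂ ps′ | _        = inj₂ ps′
  ... | inj₁ ps′ | yes refl = inj₂ ps′
  ... | inj₁ ps′ | no x≢r   = inj₁ ((e , px , x≢r) ◅ ps′)

  dropLoops : ∀ {P r q} → Path P r q → Path (λ v → P v × v ≢ r) r q
  dropLoops {r = r} ps with lastVisit r ps
  ... | inj₁ ps′ = ps′
  ... | inj₂ ps′ = ps′

  -- Via n A p q: q is reachable from p visiting only the vertices A 0, …, A (n-1),
  -- each at most once (A ∘ punchIn i is A without its i-th vertex).
  Via : (n : ℕ) → (Fin n → Fin k) → Fin k → Fin k → Set
  Via zero    A p q = p ≡ q
  Via (suc n) A p q = p ≡ q ⊎ ∃ λ i → E p (A i) × Via n (A ∘ punchIn i) (A i) q

  via? : ∀ n A p q → Dec (Via n A p q)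
  via? zero    A p q = p ≟ q
  via? (suc n) A p q =
    (p ≟ q) ⊎-dec any? (λ i → E? p (A i) ×-dec via? n (A ∘ punchIn i) (A i) q)

  via-sound : ∀ n A {p q} → Via n A p q → Reach p q
  via-sound zero    A refl                = ε
  via-sound (suc n) A (inj₁ refl)         = ε
  via-sound (suc n) A (inj₂ (i , e , via)) = (e , tt) ◅ via-sound n (A ∘ punchIn i) via

  via-complete : ∀ n A {p q} → Path (λ v → ∃ λ j → A j ≡ v) p q → Via n A p q
  via-complete zero    A ε                     = refl
  via-complete zero    A ((_ , () , _) ◅ _)
  via-complete (suc n) A ε                     = inj₁ refl
  via-complete (suc n) A ((e , j , refl) ◅ ps) =
    inj₂ (j , e , via-complete n (A ∘ punchIn j) (weaken avoid (dropLoops ps)))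
    where
    avoid : ∀ {v} → (∃ λ j′ → A j′ ≡ v) × v ≢ A j → ∃ λ j″ → A (punchIn j j″) ≡ v
    avoid ((j′ , refl) , v≢Aj) = punchOut j≢j′ , cong A (punchIn-punchOut j≢j′)
      where
      j≢j′ : j ≢ j′
      j≢j′ refl = v≢Aj refl

  reach? : ∀ p q → Dec (Reach p q)
  reach? p q = map′ (via-sound k id) (via-complete k id ∘ weaken (λ {v} _ → v , refl)) (via? k id p q)

module _ {k : ℕ} {P : Fin k → Set} (P? : ∀ q → Dec (P q)) where

  subsetOf : Subset k
  subsetOf = tabulate (isYes ∘ P?)

  ∈-subsetOf : ∀ {q} → q ∈ subsetOf ⇔ P q
  ∈-subsetOf {q} = mk⇔
    (λ q∈ → toWitness {a? = P? q} (Equivalence.from T-≡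
      (≡-trans (sym (lookup∘tabulate (isYes ∘ P?) q)) ([]=⇒lookup q∈))))
    (λ pq → lookup⇒[]= q subsetOf
      (≡-trans (lookup∘tabulate (isYes ∘ P?) q) (Equivalence.to T-≡ (fromWitness {a? = P? q} pq))))

¬⊆⇒∃∉ : ∀ {k} {A B : Subset k} → ¬ (A ⊆ B) → ∃ λ p → p ∈ A × p ∉ B
¬⊆⇒∃∉ {k} {A} {B} A⊈B
  with ¬∀⟶∃¬ k (λ p → p ∈ A → p ∈ B) (λ p → (p ∈? A) →-dec (p ∈? B))
              (λ f → A⊈B (λ {x} → f x))
... | p , ¬A⇒B with p ∈? A
...   | yes p∈A = p , p∈A , λ p∈B → ¬A⇒B (λ _ → p∈B)
...   | no  p∉A = ⊥-elim (¬A⇒B (λ p∈A → ⊥-elim (p∉A p∈A)))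

module _ {m : ℕ} (G : Automaton m) where

  τ-run? : ∀ p q → Dec (Run (toLTS G) p [] q)
  τ-run? p q = map′ toRun fromRun (reach? p q)
    where
    open FiniteReachability (λ a b → T (trans G a nothing b)) (λ a b → T? (trans G a nothing b))

    toRun : ∀ {a b} → Reach a b → Run (toLTS G) a [] b
    toRun ε              = done
    toRun ((st , _) ◅ ps) = tau st (toRun ps)

    fromRun : ∀ {a b} → Run (toLTS G) a [] b → Reach a b
    fromRun done       = ε
    fromRun (tau st r) = (st , tt) ◅ fromRun r

  τ-run-reverse : ∀ {p q} → Run (toLTS G) p [] q → Run (toLTS (reverse G)) q [] p
  τ-run-reverse done       = done
  τ-run-reverse (tau st r) = run-++ (toLTS (reverse G)) (τ-run-reverse r) (tau st done)

  τ-run-unreverse : ∀ {p q} → Run (toLTS (reverse G)) p [] q → Run (toLTS G) q [] p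
  τ-run-unreverse done       = done
  τ-run-unreverse (tau st r) = run-++ (toLTS G) (τ-run-unreverse r) (tau st done)

module _ {m : ℕ} (G : Automaton m) where

  private
    L : LTS (Fin m)
    L = toLTS G

  Successor : Subset (k G) → Fin m → Fin (k G) → Set
  Successor X σ y = ∃₂ λ x y′ → x ∈ X × T (trans G x (just σ) y′) × Run L y′ [] y

  post : Subset (k G) → Fin m → Subset (k G)
  post X σ = subsetOf λ y →
    any? λ x → any? λ y′ → (x ∈? X) ×-dec T? (trans G x (just σ) y′) ×-dec τ-run? G y′ y

  ∈-post : ∀ {X σ y} → y ∈ post X σ ⇔ Successor X σ y
  ∈-post = ∈-subsetOf _

  det-step : ∀ {X σ} → Nonempty (post X σ) → Step (det G) X (just σ) (post X σ)
  det-step ne = ne , λ y → ∈-post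

  initial : Subset (k G)
  initial = subsetOf λ q → any? λ b → (b ∈? init G) ×-dec τ-run? G b q

  ∈-initial : ∀ {q} → q ∈ initial ⇔ InUR G (init G) q
  ∈-initial = ∈-subsetOf _

  -- Sets closed under silent moves; every state of det(G) is one.
  TauClosed : Subset (k G) → Set
  TauClosed X = ∀ {x x′} → x ∈ X → Run L x [] x′ → x′ ∈ X

  initial-closed : TauClosed initial
  initial-closed x∈ r with Equivalence.to ∈-initial x∈
  ... | b , b∈ , r₀ = Equivalence.from ∈-initial (b , b∈ , run-++ L r₀ r)

  post-closed : ∀ X σ → TauClosed (post X σ)
  post-closed X σ y∈ r with Equivalence.to ∈-post y∈
  ... | x , y′ , x∈ , st , r₀ = Equivalence.from ∈-post (x , y′ , x∈ , st , run-++ L r₀ r)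

  estimate : Subset (k G) → List (Fin m) → Subset (k G)
  estimate X []      = X
  estimate X (σ ∷ u) = estimate (post X σ) u

  estimate-++ : ∀ u {v} X → estimate X (u ++ v) ≡ estimate (estimate X u) v
  estimate-++ []      X = refl
  estimate-++ (σ ∷ u) X = estimate-++ u (post X σ)

  estimate-closed : ∀ u {X} → TauClosed X → TauClosed (estimate X u)
  estimate-closed []      closed = closed
  estimate-closed (σ ∷ u) {X} _  = estimate-closed u (post-closed X σ)

  estimate-sound : ∀ u {X q} → q ∈ estimate X u → ∃ λ x → x ∈ X × Run L x u q
  estimate-sound []      q∈ = _ , q∈ , done
  estimate-sound (σ ∷ u) q∈ with estimate-sound u q∈
  ... | y , y∈ , r with Equivalence.to ∈-post y∈
  ...   | x , y′ , x∈ , st , r₀ = x , x∈ , obs st (run-++ L r₀ r)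

  estimate-complete : ∀ u {X x q} → TauClosed X → x ∈ X → Run L x u q → q ∈ estimate X u
  estimate-complete []      closed x∈ r = closed x∈ r
  estimate-complete (σ ∷ u) {X} closed x∈ r with run-uncons L r
  ... | x′ , y′ , r₀ , st , r₁ =
    estimate-complete u (post-closed X σ)
      (Equivalence.from ∈-post (x′ , y′ , closed x∈ r₀ , st , done)) r₁

  estimate-split : ∀ u {v X x z} → TauClosed X → x ∈ X → Run L x (u ++ v) z →
    ∃ λ x′ → x′ ∈ estimate X u × Run L x′ v z
  estimate-split u closed x∈ r with run-split L u r
  ... | x′ , r₁ , r₂ = x′ , estimate-complete u closed x∈ r₁ , r₂

-- The backward estimator det(G_R), reading an observation from right to left:
-- retro G Y u is the set of states from which u can be observed ending in Y.

module _ {m : ℕ} (G : Automaton m) where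

  private
    L : LTS (Fin m)
    L = toLTS G

  retro : Subset (k G) → List (Fin m) → Subset (k G)
  retro Y []      = Y
  retro Y (σ ∷ u) = post (reverse G) (retro Y u) σ

  retro-++ : ∀ u {v} Y → retro Y (u ++ v) ≡ retro (retro Y v) u
  retro-++ []      Y = refl
  retro-++ (σ ∷ u) Y = cong (λ Z → post (reverse G) Z σ) (retro-++ u Y)

  retro-sound : ∀ u {Y q} → q ∈ retro Y u → ∃ λ z → z ∈ Y × Run L q u z
  retro-sound []      q∈ = _ , q∈ , done
  retro-sound (σ ∷ u) q∈ with Equivalence.to (∈-post (reverse G)) q∈
  ... | x , y′ , x∈ , st , r₀ with retro-sound u x∈
  ...   | z , z∈ , r = z , z∈ , run-++ L (τ-run-unreverse G r₀) (obs st r)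

  -- Completeness needs Y closed under silent moves of G_R, i.e. backward ones.
  retro-complete : ∀ u {Y q z} → TauClosed (reverse G) Y → z ∈ Y → Run L q u z → q ∈ retro Y u
  retro-complete []      closed z∈ r = closed z∈ (τ-run-reverse G r)
  retro-complete (σ ∷ u) closed z∈ r with run-uncons L r
  ... | p′ , q′ , r₀ , st , r₁ = Equivalence.from (∈-post (reverse G))
    (q′ , p′ , retro-complete u closed z∈ r₁ , st , τ-run-reverse G r₀)

module _ {n : ℕ} {St : Fin n → Set} where

  _≐_ : ((i : Fin n) → St i) → ((i : Fin n) → St i) → Set
  x ≐ y = ∀ i → x i ≡ y i

  update : ((i : Fin n) → St i) → (i : Fin n) → St i → (j : Fin n) → St j
  update x i a j with i ≟ j
  ... | yes refl = a
  ... | no  _    = x j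

  update-same : ∀ x i a → update x i a i ≡ a
  update-same x i a with i ≟ i
  ... | yes refl = refl
  ... | no  i≢i  = ⊥-elim (i≢i refl)

  update-other : ∀ x i a j → j ≢ i → update x i a j ≡ x j
  update-other x i a j j≢i with i ≟ j
  ... | yes refl = ⊥-elim (j≢i refl)
  ... | no  _    = refl

  update-pointwise : (R : ∀ j → St j → Set) → ∀ x i a → R i a → (∀ j → j ≢ i → R j (x j)) →
    ∀ j → R j (update x i a j)
  update-pointwise R x i a Ra Rx j with i ≟ j
  ... | yes refl = Ra
  ... | no  i≢j  = Rx j (i≢j ∘ sym)

  update-pointwise₂ : (R : ∀ j → St j → St j → Set) → ∀ x y i a b → R i a b →
    (∀ j → j ≢ i → R j (x j) (y j)) → ∀ j → R j (update x i a j) (update y i b j)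
  update-pointwise₂ R x y i a b Rab Rxy j with i ≟ j
  ... | yes refl = Rab
  ... | no  i≢j  = Rxy j (i≢j ∘ sym)

reachable-≐ : ∀ {E n} {H : Fin n → LTS E} {x y} →
  Reachable (Sync n H) x → x ≐ y → Reachable (Sync n H) y
reachable-≐ {H = H} (start x-init) x≐y = start λ i → subst (Init (H i)) (x≐y i) (x-init i)
reachable-≐ {H = H} (step {a = nothing} r (i , st , others)) x≐y =
  step {a = nothing} r (i , subst (Step (H i) _ nothing) (x≐y i) st ,
                           λ j j≢i → ≡-trans (sym (x≐y j)) (others j j≢i))
reachable-≐ {H = H} (step {a = just e} r (shared , moves)) x≐y =
  step {a = just e} r (shared , λ i →
    (λ e∈ → subst (Step (H i) _ (just e)) (x≐y i) (proj₁ (moves i) e∈)) ,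
    (λ e∉ → ≡-trans (sym (x≐y i)) (proj₂ (moves i) e∉)))

module Composition {m : ℕ} (n : ℕ) (G : Fin n → Automaton m) where

  S : LTS (Fin m)
  S = Sync n (λ i → toLTS (G i))

  Config : Set
  Config = (i : Fin n) → Fin (k (G i))

  proj : Fin n → List (Fin m) → List (Fin m)
  proj i = filter (_∈? alph (G i))

  proj-∷ : ∀ i σ w → proj i (σ ∷ w) ≡ proj i [ σ ] ++ proj i w
  proj-∷ i σ w = filter-++ (_∈? alph (G i)) [ σ ] w

  data SingletonProjection (i : Fin n) (σ : Fin m) : List (Fin m) → Set where
    kept   : σ ∈ alph (G i) → SingletonProjection i σ [ σ ]
    erased : σ ∉ alph (G i) → SingletonProjection i σ []

  singleton-projection : ∀ i σ → SingletonProjection i σ (proj i [ σ ])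
  singleton-projection i σ with σ ∈? alph (G i)
  ... | yes σ∈ = kept σ∈
  ... | no  σ∉ = erased σ∉

  Shared : Fin m → Set
  Shared σ = ∃ λ i → σ ∈ alph (G i)

  Move : (i : Fin n) → Fin m → Fin (k (G i)) → Fin (k (G i)) → Set
  Move i σ a b = (σ ∈ alph (G i) → T (trans (G i) a (just σ) b)) × (σ ∉ alph (G i) → b ≡ a)

  move-run : ∀ i σ {a b} → Move i σ a b → Run (toLTS (G i)) a (proj i [ σ ]) b
  move-run i σ {a} (go , stay) with proj i [ σ ] | singleton-projection i σ
  ... | _ | kept σ∈   = obs (go σ∈) done
  ... | _ | erased σ∉ = subst (λ b → Run (toLTS (G i)) a [] b) (sym (stay σ∉)) done

  run-move : ∀ i σ {a u c} → Run (toLTS (G i)) a (proj i [ σ ] ++ u) c →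
    ∃₂ λ a′ b → Run (toLTS (G i)) a [] a′ × Move i σ a′ b × Run (toLTS (G i)) b u c
  run-move i σ r with proj i [ σ ] | singleton-projection i σ
  ... | _ | kept σ∈ with run-uncons (toLTS (G i)) r
  ...   | a′ , b , r₀ , st , r₁ = a′ , b , r₀ , ((λ _ → st) , λ σ∉ → ⊥-elim (σ∉ σ∈)) , r₁
  run-move i σ r | _ | erased σ∉ = _ , _ , done , ((λ σ∈ → ⊥-elim (σ∉ σ∈)) , λ _ → refl) , r

  project : ∀ {x w z} → Run S x w z → ∀ i → Run (toLTS (G i)) (x i) (proj i w) (z i)
  project done i = done
  project (tau (j , st , others) r) i with j ≟ i
  ... | yes refl = tau st (project r i)
  ... | no  j≢i  = subst (λ a → Run (toLTS (G i)) a _ _) (others i (j≢i ∘ sym)) (project r i)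
  project {x} {σ ∷ w} {z} (obs (_ , moves) r) i =
    subst (λ u → Run (toLTS (G i)) (x i) u (z i)) (sym (proj-∷ i σ w))
      (run-++ (toLTS (G i)) (move-run i σ (moves i)) (project r i))

  shared : ∀ {x w z} → Run S x w z → All Shared w
  shared done                 = []
  shared (tau _ r)            = shared r
  shared (obs (σ-shared , _) r) = σ-shared ∷ shared r

  lift-τ-component : ∀ (x : Config) i {a b} → x i ≡ a → Run (toLTS (G i)) a [] b →
    ∃ λ x′ → Run S x [] x′ × x′ i ≡ b × (∀ j → j ≢ i → x′ j ≡ x j)
  lift-τ-component x i xi≡a done = x , done , xi≡a , λ _ _ → refl
  lift-τ-component x i xi≡a (tau {q = a′} st r)
    with lift-τ-component (update x i a′) i (update-same x i a′) r
  ... | x′ , r′ , x′i≡b , others =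
    x′ , tau (i , first , λ j j≢i → update-other x i a′ j j≢i) r′ , x′i≡b ,
    λ j j≢i → ≡-trans (others j j≢i) (update-other x i a′ j j≢i)
    where
    first : T (trans (G i) (x i) nothing (update x i a′ i))
    first = subst (λ b → T (trans (G i) (x i) nothing b)) (sym (update-same x i a′))
              (subst (λ a → T (trans (G i) a nothing a′)) (sym xi≡a) st)

  -- Silent runs of all components combine into one silent run, performing the
  -- components listed in l one after the other.
  lift-τ-list : ∀ l {x z : Config} → (∀ i → Run (toLTS (G i)) (x i) [] (z i)) →
    ∃ λ x′ → Run S x [] x′ × (∀ i → i ∈ₗ l → x′ i ≡ z i) ×
             (∀ i → Run (toLTS (G i)) (x′ i) [] (z i))
  lift-τ-list []      {x} runs = x , done , (λ _ ()) , runs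
  lift-τ-list (i ∷ l) {z = z} runs with lift-τ-list l runs
  ... | x₁ , r₁ , done₁ , runs₁ with lift-τ-component x₁ i refl (runs₁ i)
  ...   | x′ , r₂ , x′i≡zi , others = x′ , run-++ S r₁ r₂ , finished , remaining
    where
    finished : ∀ j → j ∈ₗ i ∷ l → x′ j ≡ z j
    finished j (here refl) = x′i≡zi
    finished j (there j∈l) with j ≟ i
    ... | yes refl = x′i≡zi
    ... | no  j≢i  = ≡-trans (others j j≢i) (done₁ j j∈l)
    remaining : ∀ j → Run (toLTS (G j)) (x′ j) [] (z j)
    remaining j with j ≟ i
    ... | yes refl = subst (λ a → Run (toLTS (G i)) a [] (z i)) (sym x′i≡zi) done
    ... | no  j≢i  = subst (λ a → Run (toLTS (G j)) a [] (z j)) (sym (others j j≢i)) (runs₁ j)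

  lift-τ : ∀ {x z : Config} → (∀ i → Run (toLTS (G i)) (x i) [] (z i)) →
    ∃ λ z′ → Run S x [] z′ × z′ ≐ z
  lift-τ runs with lift-τ-list (allFin n) runs
  ... | z′ , r , finished , _ = z′ , r , λ i → finished i (∈-allFin i)

  lift : ∀ w {x z : Config} → All Shared w → (∀ i → Run (toLTS (G i)) (x i) (proj i w) (z i)) →
    ∃ λ z′ → Run S x w z′ × z′ ≐ z
  lift []      _           runs = lift-τ runs
  lift (σ ∷ w) {x} {z} (σ-shared ∷ w-shared) runs = continue (lift-τ τ-part)
    where
    split : ∀ i → ∃₂ λ a b →
      Run (toLTS (G i)) (x i) [] a × Move i σ a b × Run (toLTS (G i)) b (proj i w) (z i)
    split i = run-move i σ (subst (λ u → Run (toLTS (G i)) (x i) u (z i)) (proj-∷ i σ w) (runs i))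

    a b : Config
    a i = proj₁ (split i)
    b i = proj₁ (proj₂ (split i))

    τ-part : ∀ i → Run (toLTS (G i)) (x i) [] (a i)
    τ-part i = proj₁ (proj₂ (proj₂ (split i)))

    move : ∀ i → Move i σ (a i) (b i)
    move i = proj₁ (proj₂ (proj₂ (proj₂ (split i))))

    rest : ∀ i → Run (toLTS (G i)) (b i) (proj i w) (z i)
    rest i = proj₂ (proj₂ (proj₂ (proj₂ (split i))))

    continue : (∃ λ a′ → Run S x [] a′ × a′ ≐ a) → ∃ λ z′ → Run S x (σ ∷ w) z′ × z′ ≐ z
    continue (a′ , r₁ , a′≐a) with lift w w-shared rest
    ... | z′ , r₂ , z′≐z = z′ , run-++ S r₁ (obs (σ-shared , synchronised) r₂) , z′≐z
      where
      synchronised : ∀ i → Move i σ (a′ i) (b i)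
      synchronised i = subst (λ v → Move i σ v (b i)) (sym (a′≐a i)) (move i)

  -- The other components keep their old runs.
  reroute : ∀ {q₀ mid z : Config} {s t} → Init S q₀ → Run S q₀ s mid → Run S mid t z →
    ∀ i {b p e} → b ∈ init (G i) →
    Run (toLTS (G i)) b (proj i s) p → Run (toLTS (G i)) p (proj i t) e →
    ∃₂ λ q₀′ y → Init S q₀′ × Run S q₀′ s y × y i ≡ p × ∃ λ z′ → Run S y t z′
  reroute {q₀} {mid} {z} {s} {t} q₀-init run-s run-t i {b} {p} {e} b-init run-b run-p =
    continue (lift s (shared run-s) runs-s)
    where
    q₀′ : Config
    q₀′ = update q₀ i b

    init′ : Init S q₀′
    init′ = update-pointwise (λ j v → v ∈ init (G j)) q₀ i b b-init (λ j _ → q₀-init j)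

    runs-s : ∀ j → Run (toLTS (G j)) (q₀′ j) (proj j s) (update mid i p j)
    runs-s = update-pointwise₂ (λ j u v → Run (toLTS (G j)) u (proj j s) v)
               q₀ mid i b p run-b (λ j _ → project run-s j)

    runs-t : ∀ j → Run (toLTS (G j)) (update mid i p j) (proj j t) (update z i e j)
    runs-t = update-pointwise₂ (λ j u v → Run (toLTS (G j)) u (proj j t) v)
               mid z i p e run-p (λ j _ → project run-t j)

    continue : (∃ λ y → Run S q₀′ s y × y ≐ update mid i p) →
      ∃₂ λ q₀′ y → Init S q₀′ × Run S q₀′ s y × y i ≡ p × ∃ λ z′ → Run S y t z′
    continue (y , r-s , y≐) with lift t (shared run-t) (λ j →
      subst (λ v → Run (toLTS (G j)) v (proj j t) (update z i e j)) (sym (y≐ j)) (runs-t j))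
    ... | z′ , r-t , _ = q₀′ , y , init′ , r-s , ≡-trans (y≐ i) (update-same mid i p) , z′ , r-t

module Observer {m : ℕ} (n : ℕ) (G : Fin n → Automaton m) where

  open Composition n G using (S; proj; proj-∷; kept; erased; singleton-projection; Shared; project; shared; reroute)

  O : LTS (Fin m ⊎ Fin m)
  O = Sync n (λ i → TwoWayObserver (G i))

  ObserverState : Set
  ObserverState = (i : Fin n) → Subset (k (G i)) × Subset (k (G i))

  forward-move : ∀ i X Y σ → Nonempty (estimate (G i) X (proj i [ σ ])) →
    (Alph (TwoWayObserver (G i)) (Δ σ) →
       Step (TwoWayObserver (G i)) (X , Y) (just (Δ σ)) (estimate (G i) X (proj i [ σ ]) , Y)) ×
    (¬ Alph (TwoWayObserver (G i)) (Δ σ) → (estimate (G i) X (proj i [ σ ]) , Y) ≡ (X , Y))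
  forward-move i X Y σ ne with proj i [ σ ] | singleton-projection i σ
  ... | _ | kept σ∈ =
    (λ _ → inj₁ (σ , refl , σ∈) ,
           ((λ _ → σ , refl , det-step (G i) ne) , (λ σ∉ → ⊥-elim (σ∉ (σ , refl , σ∈)))) ,
           ((λ { (_ , () , _) }) , (λ _ → refl))) ,
    (λ σ∉ → ⊥-elim (σ∉ (inj₁ (σ , refl , σ∈))))
  ... | _ | erased σ∉ =
    (λ { (inj₁ (_ , refl , σ∈)) → ⊥-elim (σ∉ σ∈) ; (inj₂ (_ , () , _)) }) , (λ _ → refl)

  backward-move : ∀ i X Y σ → Nonempty (retro (G i) Y (proj i [ σ ])) →
    (Alph (TwoWayObserver (G i)) (Δᵣ σ) →
       Step (TwoWayObserver (G i)) (X , Y) (just (Δᵣ σ)) (X , retro (G i) Y (proj i [ σ ]))) ×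
    (¬ Alph (TwoWayObserver (G i)) (Δᵣ σ) → (X , retro (G i) Y (proj i [ σ ])) ≡ (X , Y))
  backward-move i X Y σ ne with proj i [ σ ] | singleton-projection i σ
  ... | _ | kept σ∈ =
    (λ _ → inj₂ (σ , refl , σ∈) ,
           ((λ { (_ , () , _) }) , (λ _ → refl)) ,
           ((λ _ → σ , refl , det-step (reverse (G i)) ne) , (λ σ∉ → ⊥-elim (σ∉ (σ , refl , σ∈))))) ,
    (λ σ∉ → ⊥-elim (σ∉ (inj₂ (σ , refl , σ∈))))
  ... | _ | erased σ∉ =
    (λ { (inj₁ (_ , () , _)) ; (inj₂ (_ , refl , σ∈)) → ⊥-elim (σ∉ σ∈) }) , (λ _ → refl)

  forward-step : ∀ σ {h : ObserverState} → Reachable O h → Shared σ →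
    (∀ i → Nonempty (estimate (G i) (proj₁ (h i)) (proj i [ σ ]))) →
    Reachable O (λ i → estimate (G i) (proj₁ (h i)) (proj i [ σ ]) , proj₂ (h i))
  forward-step σ r (i , σ∈) ne =
    step {a = just (Δ σ)} r ((i , inj₁ (σ , refl , σ∈)) , λ j → forward-move j _ _ σ (ne j))

  backward-step : ∀ σ {h : ObserverState} → Reachable O h → Shared σ →
    (∀ i → Nonempty (retro (G i) (proj₂ (h i)) (proj i [ σ ]))) →
    Reachable O (λ i → proj₁ (h i) , retro (G i) (proj₂ (h i)) (proj i [ σ ]))
  backward-step σ r (i , σ∈) ne =
    step {a = just (Δᵣ σ)} r ((i , inj₂ (σ , refl , σ∈)) , λ j → backward-move j _ _ σ (ne j))

  Follows : ∀ i → Subset (k (G i)) → List (Fin m) → Set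
  Follows i X u = TauClosed (G i) X × ∃₂ λ x z → x ∈ X × Run (toLTS (G i)) x u z

  Precedes : ∀ i → Subset (k (G i)) → List (Fin m) → Set
  Precedes i Y u = TauClosed (reverse (G i)) Y × ∃₂ λ q z → z ∈ Y × Run (toLTS (G i)) q u z

  forward-reach : ∀ s {h : ObserverState} → Reachable O h → All Shared s →
    (∀ i → Follows i (proj₁ (h i)) (proj i s)) →
    Reachable O (λ i → estimate (G i) (proj₁ (h i)) (proj i s) , proj₂ (h i))
  forward-reach []      r _ _ = r
  forward-reach (σ ∷ s) {h} r (σ-shared ∷ s-shared) follows =
    reachable-≐ (forward-reach s (forward-step σ r σ-shared (proj₁ ∘ advance)) s-shared (proj₂ ∘ advance))
      regroup
    where
    advance : ∀ i → Nonempty (estimate (G i) (proj₁ (h i)) (proj i [ σ ])) ×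
                    Follows i (estimate (G i) (proj₁ (h i)) (proj i [ σ ])) (proj i s)
    advance i with follows i
    ... | closed , x , z , x∈ , r-σs
      with estimate-split (G i) (proj i [ σ ]) closed x∈
             (subst (λ u → Run (toLTS (G i)) x u z) (proj-∷ i σ s) r-σs)
    ...   | x′ , x′∈ , r-s =
      (x′ , x′∈) , estimate-closed (G i) (proj i [ σ ]) closed , x′ , z , x′∈ , r-s

    regroup : (λ i → estimate (G i) (estimate (G i) (proj₁ (h i)) (proj i [ σ ])) (proj i s) , proj₂ (h i))
            ≐ (λ i → estimate (G i) (proj₁ (h i)) (proj i (σ ∷ s)) , proj₂ (h i))
    regroup i = cong (_, proj₂ (h i)) (begin
      estimate (G i) (estimate (G i) (proj₁ (h i)) (proj i [ σ ])) (proj i s)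
        ≡⟨ estimate-++ (G i) (proj i [ σ ]) (proj₁ (h i)) ⟨
      estimate (G i) (proj₁ (h i)) (proj i [ σ ] ++ proj i s)
        ≡⟨ cong (estimate (G i) (proj₁ (h i))) (proj-∷ i σ s) ⟨
      estimate (G i) (proj₁ (h i)) (proj i (σ ∷ s)) ∎)
      where open ≡-Reasoning

  backward-reach : ∀ t {h : ObserverState} → Reachable O h → All Shared t →
    (∀ i → Precedes i (proj₂ (h i)) (proj i t)) →
    Reachable O (λ i → proj₁ (h i) , retro (G i) (proj₂ (h i)) (proj i t))
  backward-reach []      r _ _ = r
  backward-reach (σ ∷ t) {h} r (σ-shared ∷ t-shared) precedes =
    reachable-≐ (backward-step σ (backward-reach t r t-shared (proj₂ ∘ peel)) σ-shared (proj₁ ∘ peel))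
      regroup
    where
    peel : ∀ i → Nonempty (retro (G i) (retro (G i) (proj₂ (h i)) (proj i t)) (proj i [ σ ])) ×
                 Precedes i (proj₂ (h i)) (proj i t)
    peel i with precedes i
    ... | closed , q , z , z∈ , r-σt with subst (λ u → Run (toLTS (G i)) q u z) (proj-∷ i σ t) r-σt
    ...   | r-σ-t with run-split (toLTS (G i)) (proj i [ σ ]) r-σ-t
    ...     | q′ , _ , r-t =
      (q , subst (q ∈_) (retro-++ (G i) (proj i [ σ ]) (proj₂ (h i)))
             (retro-complete (G i) (proj i [ σ ] ++ proj i t) closed z∈ r-σ-t)) ,
      closed , q′ , z , z∈ , r-t

    regroup : (λ i → proj₁ (h i) , retro (G i) (retro (G i) (proj₂ (h i)) (proj i t)) (proj i [ σ ]))
            ≐ (λ i → proj₁ (h i) , retro (G i) (proj₂ (h i)) (proj i (σ ∷ t)))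
    regroup i = cong (proj₁ (h i) ,_) (begin
      retro (G i) (retro (G i) (proj₂ (h i)) (proj i t)) (proj i [ σ ])
        ≡⟨ retro-++ (G i) (proj i [ σ ]) (proj₂ (h i)) ⟨
      retro (G i) (proj₂ (h i)) (proj i [ σ ] ++ proj i t)
        ≡⟨ cong (retro (G i) (proj₂ (h i))) (proj-∷ i σ t) ⟨
      retro (G i) (proj₂ (h i)) (proj i (σ ∷ t)) ∎)
      where open ≡-Reasoning

  twoWayState : List (Fin m) → List (Fin m) → ObserverState
  twoWayState s t i = estimate (G i) (initial (G i)) (proj i s) , retro (G i) ⊤ (proj i t)

  twoWay-reachable : ∀ {q₀ mid z s t} → Init S q₀ → Run S q₀ s mid → Run S mid t z →
    Reachable O (twoWayState s t)
  twoWay-reachable {q₀} {mid} {z} {s} {t} q₀-init run-s run-t =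
    backward-reach t (forward-reach s (start {x = h₀} h₀-init) (shared run-s) follows) (shared run-t) precedes
    where
    h₀ : ObserverState
    h₀ i = initial (G i) , ⊤

    h₀-init : Init O h₀
    h₀-init i = (λ q → ∈-initial (G i)) , (λ q → mk⇔ (λ _ → q , ∈⊤ , done) (λ _ → ∈⊤))

    follows : ∀ i → Follows i (initial (G i)) (proj i s)
    follows i = initial-closed (G i) , q₀ i , mid i ,
                Equivalence.from (∈-initial (G i)) (q₀ i , q₀-init i , done) , project run-s i

    precedes : ∀ i → Precedes i ⊤ (proj i t)
    precedes i = (λ _ _ → ∈⊤) , mid i , z i , ∈⊤ , project run-t i

  twoWay-contains : ∀ {q₀ mid z s t} → Init S q₀ → Run S q₀ s mid → Run S mid t z →
    ∀ i → mid i ∈ proj₁ (twoWayState s t i) ∩ proj₂ (twoWayState s t i)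
  twoWay-contains {q₀} {s = s} {t} q₀-init run-s run-t i = x∈p∩q⁺
    ( estimate-complete (G i) (proj i s) (initial-closed (G i))
        (Equivalence.from (∈-initial (G i)) (q₀ i , q₀-init i , done)) (project run-s i)
    , retro-complete (G i) (proj i t) (λ _ _ → ∈⊤) ∈⊤ (project run-t i))

  twoWay-witness : ∀ {s t} i {p} → p ∈ proj₁ (twoWayState s t i) ∩ proj₂ (twoWayState s t i) →
    ∃₂ λ b e → b ∈ init (G i) × Run (toLTS (G i)) b (proj i s) p × Run (toLTS (G i)) p (proj i t) e
  twoWay-witness {s} {t} i p∈ with x∈p∩q⁻ _ _ p∈
  ... | p∈X , p∈Xᵣ with estimate-sound (G i) (proj i s) p∈X | retro-sound (G i) (proj i t) p∈Xᵣ
  ...   | x , x∈ , r-s | e , _ , r-t with Equivalence.to (∈-initial (G i)) x∈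
  ...     | b , b∈ , r₀ = b , e , b∈ , run-++ (toLTS (G i)) r₀ r-s , r-t

  non-secret-alternative : ∀ {q₀ mid z s t} → Init S q₀ → Run S q₀ s mid → Run S mid t z →
    (∃ λ i → let (X , Xᵣ) = twoWayState s t i in (¬ ((X ∩ Xᵣ) ⊆ secret (G i))) ⊎ (X ∩ Xᵣ ≡ ⊥)) →
    ∃₂ λ q₀′ y → Init S q₀′ × Run S q₀′ s y × ¬ (∀ i → y i ∈ secret (G i)) ×
                 ∃ λ z′ → Run S y t z′
  non-secret-alternative {mid = mid} q₀-init run-s run-t (i , inj₂ empty) =
    ⊥-elim (∉⊥ (subst (mid i ∈_) empty (twoWay-contains q₀-init run-s run-t i)))
  non-secret-alternative {s = s} {t} q₀-init run-s run-t (i , inj₁ ⊈secret) with ¬⊆⇒∃∉ ⊈secret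
  ... | p , p∈ , p∉secret with twoWay-witness {s} {t} i p∈
  ...   | b , e , b-init , run-b , run-p with reroute q₀-init run-s run-t i b-init run-b run-p
  ...     | q₀′ , y , init′ , run-s′ , yi≡p , z′ , run-t′ =
    q₀′ , y , init′ , run-s′ ,
    (λ y-secret → p∉secret (subst (_∈ secret (G i)) yi≡p (y-secret i))) , z′ , run-t′

corollary5 : ∀ {m : ℕ} (n : ℕ) (G : Fin n → Automaton m) →
    (∀ h → Reachable (Sync n (λ i → TwoWayObserver (G i))) h →
      ∃ λ i → let (X , Xᵣ) = h i in
        (¬ ((X ∩ Xᵣ) ⊆ secret (G i))) ⊎ (X ∩ Xᵣ ≡ ⊥)) →
    InfStepOpaque (Sync n (λ i → toLTS (G i))) (λ x → ∀ i → x i ∈ secret (G i))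
corollary5 n G condition q₀ s t q₀-init (z , run) _ with run-split (Composition.S n G) s run
... | mid , run-s , run-t =
  non-secret-alternative q₀-init run-s run-t (condition _ (twoWay-reachable q₀-init run-s run-t))
  where open Observer n G
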